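{- If $v \equiv 2$ or $10 \pmod{12}$, then every nested SQS$(v)$ has at least $\frac{v^2}{4}$ ND-pairs.
   Context: A Steiner quadruple system SQS$(v)$ is a pair $(Q,\mathcal{B})$ where $Q$ is a set of $v$ points and $\mathcal{B}$ is a collection of 4-subsets of $Q$ (blocks) such that every 3-subset of $Q$ is contained in exactly one block. A nested SQS$(v)$ is an SQS$(v)$ together with a partition of each block into two 2-subsets (pairs). A pair of points is an ND-pair if it is one of the two pairs in the partition of at least one block. -}

module Defs where

open import Data.Nat using (ℕ)
open import Data.Fin using (Fin; _<_)
open import Data.List using (List; length; lookup)
open import Data.List.Membership.Propositional using (_∈_)
open import Data.List.Relation.Unary.All using (All)
open import Data.List.Relation.Unary.Any using (Any)
open import Data.List.Relation.Unary.Unique.Propositional using (Unique)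
open import Data.Product using (_×_; Σ; ∃; _,_)
open import Data.Sum using (_⊎_)
open import Relation.Binary.PropositionalEquality using (_≡_)
open import Relation.Nullary using (¬_)

-- A nested block on the point set Fin v: a 4-subset {a,b,c,d} of distinct
-- points, together with its partition into the two pairs {a,b} and {c,d}.
record NestedBlock (v : ℕ) : Set where
  constructor nblock
  field
    a b c d : Fin v
    a≢b : ¬ a ≡ b
    a≢c : ¬ a ≡ c
    a≢d : ¬ a ≡ d
    b≢c : ¬ b ≡ c
    b≢d : ¬ b ≡ d
    c≢d : ¬ c ≡ d
open NestedBlock public

_∈B_ : ∀ {v} → Fin v → NestedBlock v → Set
x ∈B β = (x ≡ a β) ⊎ (x ≡ b β) ⊎ (x ≡ c β) ⊎ (x ≡ d β)

ContainsTriple : ∀ {v} → NestedBlock v → Fin v → Fin v → Fin v → Set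
ContainsTriple β x y z = (x ∈B β) × (y ∈B β) × (z ∈B β)

IsNestedSQS : (v : ℕ) → List (NestedBlock v) → Set
IsNestedSQS v B =
  ∀ (x y z : Fin v) → x < y → y < z →
    Σ (Fin (length B)) (λ i →
      ContainsTriple (lookup B i) x y z ×
      (∀ (j : Fin (length B)) → ContainsTriple (lookup B j) x y z → j ≡ i))

IsNestPair : ∀ {v} → NestedBlock v → Fin v → Fin v → Set
IsNestPair β x y =
  ((x ≡ a β × y ≡ b β) ⊎ (x ≡ b β × y ≡ a β)) ⊎
  ((x ≡ c β × y ≡ d β) ⊎ (x ≡ d β × y ≡ c β))

IsNDPair : ∀ {v} → List (NestedBlock v) → Fin v → Fin v → Set
IsNDPair B x y = Any (λ β → IsNestPair β x y) B

AtLeastNDPairs : ∀ {v} → List (NestedBlock v) → ℕ → Set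
AtLeastNDPairs {v} B n =
  ∃ λ (L : List (Fin v × Fin v)) →
    Unique L × length L ≡ n ×
    All (λ p → let (x , y) = p in (x < y) × IsNDPair B x y) L

-- Fix a point x with m ND-partners and h other points. If y ≠ z are non-partners of x, the fourth
-- point w of the block through x, y, z must be the partner of x in that block, so w is an ND-partner
-- of x. For fixed w, y determines z (the block through x, y, w is unique), so the pairs {y, z} sent to
-- w are disjoint and there are at most ⌊h/2⌋ of them: h (h - 1) ≤ 2 m ⌊h/2⌋. As m + h = v - 1 ≡ 1
-- (mod 4), this forces m ≥ v/2, and summing over x, twice the number of ND-pairs is at least v²/2.
module Submission where

open import Defs
open import Data.Empty using (⊥-elim)
open import Data.Fin using (Fin; zero; suc; punchIn; _≟_; _<?_) renaming (_<_ to _<ᶠ_)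
open import Data.Fin.Patterns using (0F; 1F; 2F; 3F)
open import Data.Fin.Properties using (<-cmp; <-asym; <-irrefl; punchInᵢ≢i; all?; any?)
open import Data.List using (List; _++_; length; lookup; filter; tabulate; allFin; cartesianProduct; map)
open import Data.List.Membership.Propositional using (lose)
open import Data.List.Membership.Propositional.Properties using (∈-lookup)
open import Data.List.Properties using (length-++; filter-++; map-tabulate)
open import Data.List.Relation.Unary.All.Properties using (all-filter)
import Data.List.Relation.Unary.Any as Any
open import Data.List.Relation.Unary.Unique.Propositional.Properties using (filter⁺; cartesianProduct⁺; allFin⁺)
open import Data.Nat using (ℕ; zero; suc; _+_; _*_; _∸_; _/_; _%_; ⌊_/2⌋; _≤_; _<_; z≤n; s≤s; _≤?_)
open import Data.Nat.DivMod using (m≡m%n+[m/n]*n; m∣n⇒o%n%m≡o%m)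
open import Data.Nat.Divisibility using (divides)
open import Data.Nat.Properties
  using (+-*-semiring; +-comm; +-identityʳ; +-suc; +-mono-≤; +-monoˡ-≤; *-comm; *-assoc; *-identityʳ; *-monoʳ-≤; *-cancelʳ-≤;
         ≤-trans; ≤-reflexive; m≤m+n; n<1+n; n≮n; ≰⇒>; >⇒≢; m+n∸n≡m; ⌊n/2⌋-mono; n≡⌊n+n/2⌋; n≡⌈n+n/2⌉;
         module ≤-Reasoning)
open import Algebra.Properties.Semiring.Sum +-*-semiring
  using (sum; sum-syntax; sum-cong-≗; sum-remove; sum-replicate-zero; ∑-distrib-+; ∑-comm; *-distribˡ-sum; *-distribʳ-sum)
open import Data.Nat.Tactic.RingSolver using (solve-∀)
open import Data.Product using (∃; _×_; _,_; proj₁; proj₂)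
open import Data.Sum using (_⊎_; inj₁; inj₂)
open import Function using (_∘_)
open import Level using (0ℓ)
open import Relation.Binary using (Rel; Symmetric; Trichotomous; tri<; tri≈; tri>)
open import Relation.Binary.PropositionalEquality
  using (_≡_; _≢_; refl; sym; trans; cong; cong₂; subst; subst₂; module ≡-Reasoning)
open import Relation.Nullary using (Dec; yes; no; ¬_; ¬?; contradiction)
open import Relation.Nullary.Decidable using (toWitness; _×-dec_; _⊎-dec_; _→-dec_)
open import Relation.Unary using (Pred; Decidable)

⟦_⟧ : {P : Set} → Dec P → ℕ
⟦ yes _ ⟧ = 1
⟦ no _ ⟧ = 0

⟦⟧-yes : {P : Set} (P? : Dec P) → P → ⟦ P? ⟧ ≡ 1
⟦⟧-yes (yes _) _ = refl
⟦⟧-yes (no ¬p) p = ⊥-elim (¬p p)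

⟦⟧-no : {P : Set} (P? : Dec P) → ¬ P → ⟦ P? ⟧ ≡ 0
⟦⟧-no (yes p) ¬p = ⊥-elim (¬p p)
⟦⟧-no (no _) _ = refl

⟦⟧-cong : {P Q : Set} (P? : Dec P) (Q? : Dec Q) → (P → Q) → (Q → P) → ⟦ P? ⟧ ≡ ⟦ Q? ⟧
⟦⟧-cong (yes p) Q? f g = sym (⟦⟧-yes Q? (f p))
⟦⟧-cong (no ¬p) Q? f g = sym (⟦⟧-no Q? (¬p ∘ g))

∑-mono-≤ : ∀ {n} {f g : Fin n → ℕ} → (∀ i → f i ≤ g i) → ∑[ i < n ] f i ≤ ∑[ i < n ] g i
∑-mono-≤ {zero} f≤g = z≤n
∑-mono-≤ {suc n} f≤g = +-mono-≤ (f≤g zero) (∑-mono-≤ (f≤g ∘ suc))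

∑-const : ∀ n c → ∑[ i < n ] c ≡ n * c
∑-const zero c = refl
∑-const (suc n) c = cong (c +_) (∑-const n c)

∑-zero : ∀ {n} {f : Fin n → ℕ} → (∀ i → f i ≡ 0) → ∑[ i < n ] f i ≡ 0
∑-zero {n} f≡0 = trans (sum-cong-≗ f≡0) (sum-replicate-zero n)

∑-point : ∀ {n} {f : Fin n → ℕ} (i : Fin n) → (∀ j → j ≢ i → f j ≡ 0) → ∑[ j < n ] f j ≡ f i
∑-point {suc n} {f} i vanish = begin
  sum f                             ≡⟨ sum-remove f ⟩
  f i + ∑[ j < n ] f (punchIn i j)  ≡⟨ cong (f i +_) (∑-zero (λ j → vanish _ (punchInᵢ≢i i j))) ⟩
  f i + 0                           ≡⟨ +-identityʳ (f i) ⟩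
  f i                               ∎
  where open ≡-Reasoning

count : ∀ {n} {P : Pred (Fin n) 0ℓ} → Decidable P → ℕ
count {n} P? = ∑[ i < n ] ⟦ P? i ⟧

count-none : ∀ {n} {P : Pred (Fin n) 0ℓ} (P? : Decidable P) → (∀ i → ¬ P i) → count P? ≡ 0
count-none P? none = ∑-zero (λ i → ⟦⟧-no (P? i) (none i))

count-unique : ∀ {n} {P : Pred (Fin n) 0ℓ} (P? : Decidable P) {i} → P i → (∀ j → P j → j ≡ i) → count P? ≡ 1
count-unique P? {i} p unique = trans (∑-point i (λ j j≢i → ⟦⟧-no (P? j) (j≢i ∘ unique j))) (⟦⟧-yes (P? i) p)

count-≤1 : ∀ {n} {P : Pred (Fin n) 0ℓ} (P? : Decidable P) → (∀ {i j} → P i → P j → i ≡ j) → count P? ≤ 1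
count-≤1 P? unique with any? P?
... | yes (i , p) = ≤-reflexive (count-unique P? p (λ j q → unique q p))
... | no ∄p = ≤-trans (≤-reflexive (count-none P? (λ i p → ∄p (i , p)))) z≤n

count≡⟦⟧ : ∀ {n} {P : Pred (Fin n) 0ℓ} {Q : Set} (P? : Decidable P) (Q? : Dec Q) →
  (Q → ∃ λ i → P i × ∀ j → P j → j ≡ i) → (∀ {i} → P i → Q) → count P? ≡ ⟦ Q? ⟧
count≡⟦⟧ P? (yes q) unique _ = let _ , p , only = unique q in count-unique P? p only
count≡⟦⟧ P? (no ¬q) _ P⇒Q = count-none P? (λ _ → ¬q ∘ P⇒Q)

count≤⟦⟧ : ∀ {n} {P : Pred (Fin n) 0ℓ} {Q : Set} (P? : Decidable P) (Q? : Dec Q) →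
  (∀ {i j} → P i → P j → i ≡ j) → (∀ {i} → P i → Q) → count P? ≤ ⟦ Q? ⟧
count≤⟦⟧ P? (yes _) unique _ = count-≤1 P? unique
count≤⟦⟧ P? (no ¬q) _ P⇒Q = ≤-reflexive (count-none P? (λ _ → ¬q ∘ P⇒Q))

≡-⟦⟧* : ∀ {Q : Set} (Q? : Dec Q) {t c : ℕ} → (Q → t ≡ c) → (¬ Q → t ≡ 0) → t ≡ ⟦ Q? ⟧ * c
≡-⟦⟧* (yes q) {c = c} full _ = trans (full q) (sym (+-identityʳ c))
≡-⟦⟧* (no ¬q) _ empty = empty ¬q

≤-⟦⟧* : ∀ {Q : Set} (Q? : Dec Q) {t c : ℕ} → (Q → t ≤ c) → (¬ Q → t ≡ 0) → t ≤ ⟦ Q? ⟧ * c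
≤-⟦⟧* (yes q) {t} {c} bounded _ = subst (t ≤_) (sym (+-identityʳ c)) (bounded q)
≤-⟦⟧* (no ¬q) _ empty = ≤-reflexive (empty ¬q)

handshake : ∀ {n} {R : Rel (Fin n) 0ℓ} (R? : ∀ i j → Dec (R i j)) → Symmetric R → (∀ {i} → ¬ R i i) →
  ∑[ i < n ] count (R? i) ≡ 2 * ∑[ i < n ] count (λ j → (i <? j) ×-dec R? i j)
handshake {n} {R} R? R-sym R-irrefl = begin
  ∑[ i < n ] ∑[ j < n ] ⟦ R? i j ⟧              ≡⟨ sum-cong-≗ (λ i → sum-cong-≗ (split i)) ⟩
  ∑[ i < n ] ∑[ j < n ] (A i j + A j i)        ≡⟨ sum-cong-≗ (λ i → ∑-distrib-+ (A i) (λ j → A j i)) ⟩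
  ∑[ i < n ] (∑[ j < n ] A i j + ∑[ j < n ] A j i) ≡⟨ ∑-distrib-+ (λ i → ∑[ j < n ] A i j) (λ i → ∑[ j < n ] A j i) ⟩
  S + ∑[ i < n ] ∑[ j < n ] A j i              ≡⟨ cong (S +_) (∑-comm (λ i j → A j i)) ⟩
  S + S                                        ≡⟨ cong (S +_) (sym (+-identityʳ S)) ⟩
  2 * S                                        ∎
  where
  open ≡-Reasoning
  A? : ∀ i j → Dec (i <ᶠ j × R i j)
  A? i j = (i <? j) ×-dec R? i j
  A : Fin n → Fin n → ℕ
  A i j = ⟦ A? i j ⟧
  S : ℕ
  S = ∑[ i < n ] ∑[ j < n ] A i j
  ordered : ∀ {i j} → i <ᶠ j → ⟦ R? i j ⟧ ≡ A i j + A j i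
  ordered {i} {j} i<j = sym (begin
    A i j + A j i   ≡⟨ cong₂ _+_ (⟦⟧-cong (A? i j) (R? i j) proj₂ (i<j ,_)) (⟦⟧-no (A? j i) (<-asym i<j ∘ proj₁)) ⟩
    ⟦ R? i j ⟧ + 0  ≡⟨ +-identityʳ ⟦ R? i j ⟧ ⟩
    ⟦ R? i j ⟧      ∎)
  split : ∀ i j → ⟦ R? i j ⟧ ≡ A i j + A j i
  split i j with <-cmp i j
  ... | tri< i<j _ _ = ordered i<j
  ... | tri≈ _ refl _ = trans (⟦⟧-no (R? i i) R-irrefl) (sym (cong₂ _+_ (⟦⟧-no (A? i i) i≮i) (⟦⟧-no (A? i i) i≮i)))
    where
    i≮i : ¬ (i <ᶠ i × R i i)
    i≮i = <-irrefl refl ∘ proj₁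
  ... | tri> _ _ j<i = trans (⟦⟧-cong (R? i j) (R? j i) R-sym R-sym) (trans (ordered j<i) (+-comm (A j i) (A i j)))

length-filter-tabulate : ∀ {n} {A : Set} {P : Pred A 0ℓ} (P? : Decidable P) (f : Fin n → A) →
  length (filter P? (tabulate f)) ≡ ∑[ i < n ] ⟦ P? (f i) ⟧
length-filter-tabulate {zero} P? f = refl
length-filter-tabulate {suc n} P? f with P? (f zero)
... | yes _ = cong suc (length-filter-tabulate P? (f ∘ suc))
... | no _ = length-filter-tabulate P? (f ∘ suc)

length-filter-cartesianProduct : ∀ {m} {A B : Set} {P : Pred (A × B) 0ℓ} (P? : Decidable P)
  (f : Fin m → A) (ys : List B) →
  length (filter P? (cartesianProduct (tabulate f) ys)) ≡ ∑[ i < m ] length (filter P? (map (f i ,_) ys))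
length-filter-cartesianProduct {zero} P? f ys = refl
length-filter-cartesianProduct {suc m} {A} {B} P? f ys = begin
  length (filter P? (map (f zero ,_) ys ++ rest))           ≡⟨ cong length (filter-++ P? (map (f zero ,_) ys) rest) ⟩
  length (filter P? (map (f zero ,_) ys) ++ filter P? rest) ≡⟨ length-++ (filter P? (map (f zero ,_) ys)) ⟩
  length (filter P? (map (f zero ,_) ys)) + length (filter P? rest)
    ≡⟨ cong (length (filter P? (map (f zero ,_) ys)) +_) (length-filter-cartesianProduct P? (f ∘ suc) ys) ⟩
  ∑[ i < suc m ] length (filter P? (map (f i ,_) ys))       ∎
  where
  open ≡-Reasoning
  rest : List (A × B)
  rest = cartesianProduct (tabulate (f ∘ suc)) ys

length-filter-allPairs : ∀ {n} {P : Pred (Fin n × Fin n) 0ℓ} (P? : Decidable P) →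
  length (filter P? (cartesianProduct (allFin n) (allFin n))) ≡ ∑[ i < n ] ∑[ j < n ] ⟦ P? (i , j) ⟧
length-filter-allPairs {n} P? = trans (length-filter-cartesianProduct P? (λ i → i) (allFin n))
  (sum-cong-≗ λ i → trans (cong (length ∘ filter P?) (map-tabulate (λ j → j) (i ,_))) (length-filter-tabulate P? (i ,_)))

data Halves : ℕ → Set where
  even : ∀ q → Halves (q + q)
  odd  : ∀ q → Halves (suc (q + q))

halves : ∀ n → Halves n
halves zero = even 0
halves (suc n) with halves n
... | even q = odd q
... | odd q = subst Halves (cong suc (+-suc q q)) (even (suc q))

half-≤ : ∀ {q n} → q + q ≤ suc (n + n) → q ≤ n
half-≤ {q} {n} le = subst₂ _≤_ (sym (n≡⌊n+n/2⌋ q)) (sym (n≡⌈n+n/2⌉ n)) (⌊n/2⌋-mono le)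

twice-half : ∀ s {h} → 2 * s ≤ h → 2 * s ≤ 2 * ⌊ h /2⌋
twice-half s {h} 2s≤h = *-monoʳ-≤ 2 (subst (_≤ ⌊ h /2⌋) (sym (n≡⌊n+n/2⌋ s)) (⌊n/2⌋-mono s+s≤h))
  where
  s+s≤h : s + s ≤ h
  s+s≤h = subst (_≤ h) (cong (s +_) (+-identityʳ s)) 2s≤h

double-half-even : ∀ q → 2 * ⌊ q + q /2⌋ ≡ q + q
double-half-even q = trans (cong (2 *_) (sym (n≡⌊n+n/2⌋ q))) (cong (q +_) (+-identityʳ q))

double-half-odd : ∀ q → 2 * ⌊ suc (q + q) /2⌋ ≡ q + q
double-half-odd q = trans (cong (2 *_) (sym (n≡⌈n+n/2⌉ q))) (cong (q +_) (+-identityʳ q))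

few-nonpartners : ∀ {n m h} → 1 ≤ n → m ≤ n + n → h * (h ∸ 1) ≤ m * (2 * ⌊ h /2⌋) → h ≤ n + n
few-nonpartners {n} {m} {h} 1≤n m≤2n bound with halves h
... | even zero = z≤n
... | odd zero = ≤-trans 1≤n (m≤m+n n n)
... | even q@(suc _) = +-mono-≤ q≤n q≤n
  where
  h∸1≤m : q + q ∸ 1 ≤ m
  h∸1≤m = *-cancelʳ-≤ _ m (q + q) (subst₂ _≤_ (*-comm (q + q) (q + q ∸ 1)) (cong (m *_) (double-half-even q)) bound)
  q≤n : q ≤ n
  q≤n = half-≤ (s≤s (≤-trans h∸1≤m m≤2n))
... | odd q@(suc _) = ≤-trans h≤m m≤2n
  where
  h≤m : suc (q + q) ≤ m
  h≤m = *-cancelʳ-≤ _ m (q + q) (subst (suc (q + q) * (q + q) ≤_) (cong (m *_) (double-half-odd q)) bound)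

majority-4n+2 : ∀ {n m h} → 1 ≤ n → m + h + 1 ≡ 4 * n + 2 → h * (h ∸ 1) ≤ m * (2 * ⌊ h /2⌋) → 4 * n + 2 ≤ 2 * m
majority-4n+2 {n} {m} {h} 1≤n total bound with m ≤? n + n
... | yes m≤2n = contradiction too-small (n≮n (4 * n + 2))
  where
  too-small : 4 * n + 2 < 4 * n + 2
  too-small = begin-strict
    4 * n + 2                 ≡⟨ sym total ⟩
    m + h + 1                 ≤⟨ +-monoˡ-≤ 1 (+-mono-≤ m≤2n (few-nonpartners 1≤n m≤2n bound)) ⟩
    (n + n) + (n + n) + 1     <⟨ n<1+n _ ⟩
    suc ((n + n) + (n + n) + 1) ≡⟨ four-n-plus-two n ⟩
    4 * n + 2                 ∎
    where
    open ≤-Reasoning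
    four-n-plus-two : ∀ n → suc ((n + n) + (n + n) + 1) ≡ 4 * n + 2
    four-n-plus-two = solve-∀
... | no m≰2n = subst (_≤ 2 * m) (four-n-plus-two n) (*-monoʳ-≤ 2 (≰⇒> m≰2n))
  where
  four-n-plus-two : ∀ n → 2 * suc (n + n) ≡ 4 * n + 2
  four-n-plus-two = solve-∀

%12⇒%4 : ∀ v → v % 12 ≡ 2 ⊎ v % 12 ≡ 10 → v % 4 ≡ 2
%12⇒%4 v v%12 = trans (sym (m∣n⇒o%n%m≡o%m 4 12 v (divides 3 refl))) (reduce v%12)
  where
  reduce : v % 12 ≡ 2 ⊎ v % 12 ≡ 10 → v % 12 % 4 ≡ 2
  reduce (inj₁ eq) = cong (_% 4) eq
  reduce (inj₂ eq) = cong (_% 4) eq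

majority : ∀ {v m h} → v % 4 ≡ 2 → 2 < v → m + h + 1 ≡ v → h * (h ∸ 1) ≤ m * (2 * ⌊ h /2⌋) → v ≤ 2 * m
majority {v} {m} {h} v%4≡2 2<v total bound =
  subst (_≤ 2 * m) (sym v≡4n+2) (majority-4n+2 {n} {m} {h} 1≤n (trans total v≡4n+2) bound)
  where
  n : ℕ
  n = v / 4
  v≡4n+2 : v ≡ 4 * n + 2
  v≡4n+2 = begin
    v              ≡⟨ m≡m%n+[m/n]*n v 4 ⟩
    v % 4 + n * 4  ≡⟨ cong (_+ n * 4) v%4≡2 ⟩
    2 + n * 4      ≡⟨ +-comm 2 (n * 4) ⟩
    n * 4 + 2      ≡⟨ cong (_+ 2) (*-comm n 4) ⟩
    4 * n + 2      ∎
    where open ≡-Reasoning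
  1≤n : 1 ≤ n
  1≤n with n | v≡4n+2
  ... | zero | v≡2 = contradiction v≡2 (>⇒≢ 2<v)
  ... | suc _ | _ = s≤s z≤n

missing : (i j k : Fin 4) → ∃ λ l → l ≢ i × l ≢ j × l ≢ k
missing = toWitness {a? = all? λ i → all? λ j → all? λ k → any? λ l → ¬? (l ≟ i) ×-dec ¬? (l ≟ j) ×-dec ¬? (l ≟ k)} _

missing-unique : (i j k l l′ : Fin 4) → i ≢ j → i ≢ k → j ≢ k →
  l ≢ i → l ≢ j → l ≢ k → l′ ≢ i → l′ ≢ j → l′ ≢ k → l ≡ l′
missing-unique = toWitness {a? = all? λ i → all? λ j → all? λ k → all? λ l → all? λ l′ →
  ¬? (i ≟ j) →-dec ¬? (i ≟ k) →-dec ¬? (j ≟ k) →-dec ¬? (l ≟ i) →-dec ¬? (l ≟ j) →-dec ¬? (l ≟ k) →-dec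
  ¬? (l′ ≟ i) →-dec ¬? (l′ ≟ j) →-dec ¬? (l′ ≟ k) →-dec l ≟ l′} _

module _ {v : ℕ} (β : NestedBlock v) where

  point : Fin 4 → Fin v
  point 0F = a β
  point 1F = b β
  point 2F = c β
  point 3F = d β

  point∈B : ∀ i → point i ∈B β
  point∈B 0F = inj₁ refl
  point∈B 1F = inj₂ (inj₁ refl)
  point∈B 2F = inj₂ (inj₂ (inj₁ refl))
  point∈B 3F = inj₂ (inj₂ (inj₂ refl))

  ∈B⇒point : ∀ {x} → x ∈B β → ∃ λ i → point i ≡ x
  ∈B⇒point (inj₁ refl) = 0F , refl
  ∈B⇒point (inj₂ (inj₁ refl)) = 1F , refl
  ∈B⇒point (inj₂ (inj₂ (inj₁ refl))) = 2F , refl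
  ∈B⇒point (inj₂ (inj₂ (inj₂ refl))) = 3F , refl

  point-injective : ∀ {i j} → point i ≡ point j → i ≡ j
  point-injective {0F} {0F} _ = refl
  point-injective {0F} {1F} eq = ⊥-elim (a≢b β eq)
  point-injective {0F} {2F} eq = ⊥-elim (a≢c β eq)
  point-injective {0F} {3F} eq = ⊥-elim (a≢d β eq)
  point-injective {1F} {0F} eq = ⊥-elim (a≢b β (sym eq))
  point-injective {1F} {1F} _ = refl
  point-injective {1F} {2F} eq = ⊥-elim (b≢c β eq)
  point-injective {1F} {3F} eq = ⊥-elim (b≢d β eq)
  point-injective {2F} {0F} eq = ⊥-elim (a≢c β (sym eq))
  point-injective {2F} {1F} eq = ⊥-elim (b≢c β (sym eq))
  point-injective {2F} {2F} _ = refl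
  point-injective {2F} {3F} eq = ⊥-elim (c≢d β eq)
  point-injective {3F} {0F} eq = ⊥-elim (a≢d β (sym eq))
  point-injective {3F} {1F} eq = ⊥-elim (b≢d β (sym eq))
  point-injective {3F} {2F} eq = ⊥-elim (c≢d β (sym eq))
  point-injective {3F} {3F} _ = refl

  fourth-point : ∀ {x y z} → x ∈B β → y ∈B β → z ∈B β → ∃ λ w → w ∈B β × w ≢ x × w ≢ y × w ≢ z
  fourth-point x∈ y∈ z∈ with ∈B⇒point x∈ | ∈B⇒point y∈ | ∈B⇒point z∈
  ... | i , refl | j , refl | k , refl with missing i j k
  ... | l , l≢i , l≢j , l≢k = point l , point∈B l , l≢i ∘ point-injective , l≢j ∘ point-injective , l≢k ∘ point-injective

  fourth-point-unique : ∀ {x y z w w′} → x ∈B β → y ∈B β → z ∈B β → w ∈B β → w′ ∈B β →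
    x ≢ y → x ≢ z → y ≢ z → w ≢ x → w ≢ y → w ≢ z → w′ ≢ x → w′ ≢ y → w′ ≢ z → w ≡ w′
  fourth-point-unique x∈ y∈ z∈ w∈ w′∈ x≢y x≢z y≢z w≢x w≢y w≢z w′≢x w′≢y w′≢z
    with ∈B⇒point x∈ | ∈B⇒point y∈ | ∈B⇒point z∈ | ∈B⇒point w∈ | ∈B⇒point w′∈
  ... | i , refl | j , refl | k , refl | l , refl | l′ , refl =
    cong point (missing-unique i j k l l′ (x≢y ∘ cong point) (x≢z ∘ cong point) (y≢z ∘ cong point)
      (w≢x ∘ cong point) (w≢y ∘ cong point) (w≢z ∘ cong point) (w′≢x ∘ cong point) (w′≢y ∘ cong point) (w′≢z ∘ cong point))

  nest-partner : ∀ {x} → x ∈B β → ∃ λ p → p ∈B β × p ≢ x × IsNestPair β x p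
  nest-partner (inj₁ refl) = b β , point∈B 1F , a≢b β ∘ sym , inj₁ (inj₁ (refl , refl))
  nest-partner (inj₂ (inj₁ refl)) = a β , point∈B 0F , a≢b β , inj₁ (inj₂ (refl , refl))
  nest-partner (inj₂ (inj₂ (inj₁ refl))) = d β , point∈B 3F , c≢d β ∘ sym , inj₂ (inj₁ (refl , refl))
  nest-partner (inj₂ (inj₂ (inj₂ refl))) = c β , point∈B 2F , c≢d β , inj₂ (inj₂ (refl , refl))

  nest-sym : ∀ {x y} → IsNestPair β x y → IsNestPair β y x
  nest-sym (inj₁ (inj₁ (p , q))) = inj₁ (inj₂ (q , p))
  nest-sym (inj₁ (inj₂ (p , q))) = inj₁ (inj₁ (q , p))
  nest-sym (inj₂ (inj₁ (p , q))) = inj₂ (inj₂ (q , p))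
  nest-sym (inj₂ (inj₂ (p , q))) = inj₂ (inj₁ (q , p))

  nest-irrefl : ∀ {x} → ¬ IsNestPair β x x
  nest-irrefl (inj₁ (inj₁ (refl , q))) = a≢b β q
  nest-irrefl (inj₁ (inj₂ (refl , q))) = a≢b β (sym q)
  nest-irrefl (inj₂ (inj₁ (refl , q))) = c≢d β q
  nest-irrefl (inj₂ (inj₂ (refl , q))) = c≢d β (sym q)

  nest? : ∀ x y → Dec (IsNestPair β x y)
  nest? x y = (((x ≟ a β) ×-dec (y ≟ b β)) ⊎-dec ((x ≟ b β) ×-dec (y ≟ a β))) ⊎-dec
              (((x ≟ c β) ×-dec (y ≟ d β)) ⊎-dec ((x ≟ d β) ×-dec (y ≟ c β)))

_∈B?_ : ∀ {v} (x : Fin v) (β : NestedBlock v) → Dec (x ∈B β)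
x ∈B? β = (x ≟ a β) ⊎-dec (x ≟ b β) ⊎-dec (x ≟ c β) ⊎-dec (x ≟ d β)

wlog-increasing : ∀ {A : Set} {_<_ : Rel A 0ℓ} {P : A → A → A → Set} → Trichotomous _≡_ _<_ →
  (∀ {x y z} → P x y z → P y x z) → (∀ {x y z} → P x y z → P x z y) →
  (∀ {x y z} → x < y → y < z → P x y z) → ∀ {x y z} → x ≢ y → x ≢ z → y ≢ z → P x y z
wlog-increasing {_<_ = _<_} {P} compare swap₁₂ swap₂₃ increasing = distinct
  where
  first-two-increasing : ∀ {x y z} → x < y → x ≢ z → y ≢ z → P x y z
  first-two-increasing {x} {y} {z} x<y x≢z y≢z with compare y z
  ... | tri< y<z _ _ = increasing x<y y<z
  ... | tri≈ _ y≡z _ = ⊥-elim (y≢z y≡z)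
  ... | tri> _ _ z<y with compare x z
  ...   | tri< x<z _ _ = swap₂₃ (increasing x<z z<y)
  ...   | tri≈ _ x≡z _ = ⊥-elim (x≢z x≡z)
  ...   | tri> _ _ z<x = swap₂₃ (swap₁₂ (increasing z<x x<y))
  distinct : ∀ {x y z} → x ≢ y → x ≢ z → y ≢ z → P x y z
  distinct {x} {y} x≢y x≢z y≢z with compare x y
  ... | tri< x<y _ _ = first-two-increasing x<y x≢z y≢z
  ... | tri≈ _ x≡y _ = ⊥-elim (x≢y x≡y)
  ... | tri> _ _ y<x = swap₁₂ (first-two-increasing y<x y≢z x≢z)

module NestedSQS {v : ℕ} {B : List (NestedBlock v)} (sqs : IsNestedSQS v B) where

  ND? : ∀ x y → Dec (IsNDPair B x y)
  ND? x y = Any.any? (λ β → nest? β x y) B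

  ND-sym : ∀ {x y} → IsNDPair B x y → IsNDPair B y x
  ND-sym = Any.map λ {β} → nest-sym β

  ND-irrefl : ∀ {x} → ¬ IsNDPair B x x
  ND-irrefl nd = let β , nest = Any.satisfied nd in nest-irrefl β nest

  UniqueBlock : Fin v → Fin v → Fin v → Set
  UniqueBlock x y z = ∃ λ i → ContainsTriple (lookup B i) x y z × (∀ j → ContainsTriple (lookup B j) x y z → j ≡ i)

  uniqueBlock : ∀ {x y z} → x ≢ y → x ≢ z → y ≢ z → UniqueBlock x y z
  uniqueBlock = wlog-increasing <-cmp swap₁₂ swap₂₃ (λ x<y y<z → sqs _ _ _ x<y y<z)
    where
    swap₁₂ : ∀ {x y z} → UniqueBlock x y z → UniqueBlock y x z
    swap₁₂ (i , (x∈ , y∈ , z∈) , unique) = i , (y∈ , x∈ , z∈) , λ j (y∈ , x∈ , z∈) → unique j (x∈ , y∈ , z∈)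
    swap₂₃ : ∀ {x y z} → UniqueBlock x y z → UniqueBlock x z y
    swap₂₃ (i , (x∈ , y∈ , z∈) , unique) = i , (x∈ , z∈ , y∈) , λ j (x∈ , z∈ , y∈) → unique j (x∈ , y∈ , z∈)

  InBlock : Fin v → Fin v → Fin v → Fin v → Set
  InBlock x y z w = ∃ λ i → ContainsTriple (lookup B i) x y z × w ∈B lookup B i

  InBlock? : ∀ x y z w → Dec (InBlock x y z w)
  InBlock? x y z w = any? λ i → (x ∈B? lookup B i ×-dec y ∈B? lookup B i ×-dec z ∈B? lookup B i) ×-dec w ∈B? lookup B i

  completion : ∀ {x y z} → x ≢ y → x ≢ z → y ≢ z → ∃ λ w → InBlock x y z w × w ≢ x × w ≢ y × w ≢ z
  completion x≢y x≢z y≢z with uniqueBlock x≢y x≢z y≢z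
  ... | i , (x∈ , y∈ , z∈) , _ with fourth-point (lookup B i) x∈ y∈ z∈
  ... | w , w∈ , w≢x , w≢y , w≢z = w , (i , (x∈ , y∈ , z∈) , w∈) , w≢x , w≢y , w≢z

  completion-unique : ∀ {x y z w w′} → x ≢ y → x ≢ z → y ≢ z → InBlock x y z w → InBlock x y z w′ →
    w ≢ x → w ≢ y → w ≢ z → w′ ≢ x → w′ ≢ y → w′ ≢ z → w ≡ w′
  completion-unique {w′ = w′} x≢y x≢z y≢z (i , (x∈ , y∈ , z∈) , w∈) (i′ , xyz∈′ , w′∈′) with uniqueBlock x≢y x≢z y≢z
  ... | _ , _ , unique = fourth-point-unique (lookup B i) x∈ y∈ z∈ w∈ w′∈ x≢y x≢z y≢z
    where
    w′∈ : w′ ∈B lookup B i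
    w′∈ = subst (λ j → w′ ∈B lookup B j) (trans (unique i′ xyz∈′) (sym (unique i (x∈ , y∈ , z∈)))) w′∈′

  completion-of-nonpartners : ∀ {x y z w} → ¬ IsNDPair B x y → ¬ IsNDPair B x z → x ≢ y → x ≢ z → y ≢ z →
    InBlock x y z w → w ≢ x → w ≢ y → w ≢ z → IsNDPair B x w
  completion-of-nonpartners {x} {w = w} ¬xy ¬xz x≢y x≢z y≢z (i , (x∈ , y∈ , z∈) , w∈) w≢x w≢y w≢z
    with nest-partner (lookup B i) x∈
  ... | p , p∈ , p≢x , nest = subst (IsNDPair B x) p≡w xp
    where
    xp : IsNDPair B x p
    xp = lose (∈-lookup i) nest
    p≡w : p ≡ w
    p≡w = fourth-point-unique (lookup B i) x∈ y∈ z∈ p∈ w∈ x≢y x≢z y≢z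
      p≢x (λ p≡y → ¬xy (subst (IsNDPair B x) p≡y xp)) (λ p≡z → ¬xz (subst (IsNDPair B x) p≡z xp)) w≢x w≢y w≢z

  module AtPoint (x : Fin v) where

    NonPartner : Fin v → Set
    NonPartner y = y ≢ x × ¬ IsNDPair B x y

    NonPartner? : ∀ y → Dec (NonPartner y)
    NonPartner? y = ¬? (y ≟ x) ×-dec ¬? (ND? x y)

    NonPartnerPair : Fin v → Fin v → Set
    NonPartnerPair y z = NonPartner y × NonPartner z × y ≢ z

    NonPartnerPair? : ∀ y z → Dec (NonPartnerPair y z)
    NonPartnerPair? y z = NonPartner? y ×-dec NonPartner? z ×-dec ¬? (y ≟ z)

    Completes : Fin v → Fin v → Fin v → Set
    Completes w y z = NonPartnerPair y z × InBlock x y z w × w ≢ x × w ≢ y × w ≢ z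

    Completes? : ∀ w y z → Dec (Completes w y z)
    Completes? w y z = NonPartnerPair? y z ×-dec InBlock? x y z w ×-dec ¬? (w ≟ x) ×-dec ¬? (w ≟ y) ×-dec ¬? (w ≟ z)

    degree nonpartners : ℕ
    degree = count (ND? x)
    nonpartners = count NonPartner?

    partition : ∀ y → ⟦ ND? x y ⟧ + ⟦ NonPartner? y ⟧ + ⟦ y ≟ x ⟧ ≡ 1
    partition y = by-cases (y ≟ x) (ND? x y)
      where
      by-cases : Dec (y ≡ x) → Dec (IsNDPair B x y) → ⟦ ND? x y ⟧ + ⟦ NonPartner? y ⟧ + ⟦ y ≟ x ⟧ ≡ 1
      by-cases (yes y≡x) _
        rewrite ⟦⟧-no (ND? x y) (ND-irrefl ∘ subst (IsNDPair B x) y≡x)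
              | ⟦⟧-no (NonPartner? y) (λ (y≢x , _) → y≢x y≡x) | ⟦⟧-yes (y ≟ x) y≡x = refl
      by-cases (no y≢x) (yes xy)
        rewrite ⟦⟧-yes (ND? x y) xy | ⟦⟧-no (NonPartner? y) (λ (_ , ¬xy) → ¬xy xy) | ⟦⟧-no (y ≟ x) y≢x = refl
      by-cases (no y≢x) (no ¬xy)
        rewrite ⟦⟧-no (ND? x y) ¬xy | ⟦⟧-yes (NonPartner? y) (y≢x , ¬xy) | ⟦⟧-no (y ≟ x) y≢x = refl

    degree+nonpartners : degree + nonpartners + 1 ≡ v
    degree+nonpartners = begin
      degree + nonpartners + 1
        ≡⟨ cong (degree + nonpartners +_) (sym (count-unique (_≟ x) refl (λ _ y≡x → y≡x))) ⟩
      degree + nonpartners + count (_≟ x)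
        ≡⟨ cong (_+ count (_≟ x)) (sym (∑-distrib-+ (λ y → ⟦ ND? x y ⟧) (λ y → ⟦ NonPartner? y ⟧))) ⟩
      ∑[ y < v ] (⟦ ND? x y ⟧ + ⟦ NonPartner? y ⟧) + count (_≟ x)
        ≡⟨ sym (∑-distrib-+ (λ y → ⟦ ND? x y ⟧ + ⟦ NonPartner? y ⟧) (λ y → ⟦ y ≟ x ⟧)) ⟩
      ∑[ y < v ] (⟦ ND? x y ⟧ + ⟦ NonPartner? y ⟧ + ⟦ y ≟ x ⟧)
        ≡⟨ sum-cong-≗ partition ⟩
      ∑[ y < v ] 1
        ≡⟨ trans (∑-const v 1) (*-identityʳ v) ⟩
      v ∎
      where open ≡-Reasoning

    completions-of-pair : ∀ y z → count (λ w → Completes? w y z) ≡ ⟦ NonPartnerPair? y z ⟧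
    completions-of-pair y z = count≡⟦⟧ (λ w → Completes? w y z) (NonPartnerPair? y z) exists-unique proj₁
      where
      exists-unique : NonPartnerPair y z → ∃ λ w → Completes w y z × ∀ w′ → Completes w′ y z → w′ ≡ w
      exists-unique pair@((y≢x , _) , (z≢x , _) , y≢z) =
        let w , in-block , w≢x , w≢y , w≢z = completion (y≢x ∘ sym) (z≢x ∘ sym) y≢z
        in w , (pair , in-block , w≢x , w≢y , w≢z) , λ w′ (_ , in-block′ , w′≢x , w′≢y , w′≢z) →
             completion-unique (y≢x ∘ sym) (z≢x ∘ sym) y≢z in-block′ in-block w′≢x w′≢y w′≢z w≢x w≢y w≢z

    Completes-sym : ∀ {w y z} → Completes w y z → Completes w z y
    Completes-sym ((ny , nz , y≢z) , (i , (x∈ , y∈ , z∈) , w∈) , w≢x , w≢y , w≢z) =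
      (nz , ny , y≢z ∘ sym) , (i , (x∈ , z∈ , y∈) , w∈) , w≢x , w≢z , w≢y

    Completes-irrefl : ∀ {w y} → ¬ Completes w y y
    Completes-irrefl ((_ , _ , y≢y) , _) = y≢y refl

    Completes-functional : ∀ {w y z z′} → Completes w y z → Completes w y z′ → z ≡ z′
    Completes-functional (((y≢x , _) , (z≢x , _) , y≢z) , (i , (x∈ , y∈ , z∈) , w∈) , w≢x , w≢y , w≢z)
                         ((_ , (z′≢x , _) , y≢z′) , (i′ , (x∈′ , y∈′ , z′∈) , w∈′) , _ , _ , w≢z′) =
      completion-unique (y≢x ∘ sym) (w≢x ∘ sym) (w≢y ∘ sym) (i , (x∈ , y∈ , w∈) , z∈) (i′ , (x∈′ , y∈′ , w∈′) , z′∈)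
        z≢x (y≢z ∘ sym) (w≢z ∘ sym) z′≢x (y≢z′ ∘ sym) (w≢z′ ∘ sym)

    pairs-with : ∀ {y} → NonPartner y → count (NonPartnerPair? y) ≡ nonpartners ∸ 1
    pairs-with {y} ny = sym (begin
      nonpartners ∸ 1
        ≡⟨ cong (_∸ 1) (sum-cong-≗ split) ⟩
      ∑[ z < v ] (⟦ NonPartnerPair? y z ⟧ + ⟦ z ≟ y ⟧) ∸ 1
        ≡⟨ cong (_∸ 1) (∑-distrib-+ (λ z → ⟦ NonPartnerPair? y z ⟧) (λ z → ⟦ z ≟ y ⟧)) ⟩
      count (NonPartnerPair? y) + count (_≟ y) ∸ 1
        ≡⟨ cong (λ n → count (NonPartnerPair? y) + n ∸ 1) (count-unique (_≟ y) refl (λ _ z≡y → z≡y)) ⟩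
      count (NonPartnerPair? y) + 1 ∸ 1
        ≡⟨ m+n∸n≡m (count (NonPartnerPair? y)) 1 ⟩
      count (NonPartnerPair? y) ∎)
      where
      open ≡-Reasoning
      split : ∀ z → ⟦ NonPartner? z ⟧ ≡ ⟦ NonPartnerPair? y z ⟧ + ⟦ z ≟ y ⟧
      split z with z ≟ y
      ... | yes refl = trans (⟦⟧-yes (NonPartner? y) ny)
                             (sym (cong (_+ 1) (⟦⟧-no (NonPartnerPair? y y) (λ (_ , _ , y≢y) → y≢y refl))))
      ... | no z≢y = trans (⟦⟧-cong (NonPartner? z) (NonPartnerPair? y z) (λ nz → ny , nz , z≢y ∘ sym) (proj₁ ∘ proj₂))
                           (sym (+-identityʳ _))

    ordered-nonpartner-pairs : ∑[ y < v ] count (NonPartnerPair? y) ≡ nonpartners * (nonpartners ∸ 1)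
    ordered-nonpartner-pairs = trans (sum-cong-≗ row) (sym (*-distribʳ-sum (nonpartners ∸ 1) (λ y → ⟦ NonPartner? y ⟧)))
      where
      row : ∀ y → count (NonPartnerPair? y) ≡ ⟦ NonPartner? y ⟧ * (nonpartners ∸ 1)
      row y = ≡-⟦⟧* (NonPartner? y) pairs-with (λ ¬ny → count-none (NonPartnerPair? y) (λ _ → ¬ny ∘ proj₁))

    pairs-completed-by : ∀ w → ∑[ y < v ] count (Completes? w y) ≤ ⟦ ND? x w ⟧ * (2 * ⌊ nonpartners /2⌋)
    pairs-completed-by w = ≤-⟦⟧* (ND? x w) even-and-bounded only-partners-complete
      where
      at-most-one : ∀ y → count (Completes? w y) ≤ ⟦ NonPartner? y ⟧
      at-most-one y = count≤⟦⟧ (Completes? w y) (NonPartner? y) Completes-functional (proj₁ ∘ proj₁)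
      even-and-bounded : IsNDPair B x w → ∑[ y < v ] count (Completes? w y) ≤ 2 * ⌊ nonpartners /2⌋
      even-and-bounded _ = begin
        ∑[ y < v ] count (Completes? w y)  ≡⟨ matching ⟩
        2 * unordered                      ≤⟨ twice-half unordered (subst (_≤ nonpartners) matching (∑-mono-≤ at-most-one)) ⟩
        2 * ⌊ nonpartners /2⌋              ∎
        where
        open ≤-Reasoning
        unordered : ℕ
        unordered = ∑[ y < v ] count (λ z → (y <? z) ×-dec Completes? w y z)
        matching : ∑[ y < v ] count (Completes? w y) ≡ 2 * unordered
        matching = handshake (Completes? w) Completes-sym Completes-irrefl
      only-partners-complete : ¬ IsNDPair B x w → ∑[ y < v ] count (Completes? w y) ≡ 0
      only-partners-complete ¬xw = ∑-zero λ y → count-none (Completes? w y)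
        λ _ (((y≢x , ¬xy) , (z≢x , ¬xz) , y≢z) , in-block , w≢x , w≢y , w≢z) →
          ¬xw (completion-of-nonpartners ¬xy ¬xz (y≢x ∘ sym) (z≢x ∘ sym) y≢z in-block w≢x w≢y w≢z)

    nonpartner-pairs-bound : nonpartners * (nonpartners ∸ 1) ≤ degree * (2 * ⌊ nonpartners /2⌋)
    nonpartner-pairs-bound = begin
      nonpartners * (nonpartners ∸ 1)                       ≡⟨ sym ordered-nonpartner-pairs ⟩
      ∑[ y < v ] ∑[ z < v ] ⟦ NonPartnerPair? y z ⟧         ≡⟨ sum-cong-≗ (λ y → sum-cong-≗ (sym ∘ completions-of-pair y)) ⟩
      ∑[ y < v ] ∑[ z < v ] ∑[ w < v ] ⟦ Completes? w y z ⟧ ≡⟨ sum-cong-≗ (λ y → ∑-comm (λ z w → ⟦ Completes? w y z ⟧)) ⟩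
      ∑[ y < v ] ∑[ w < v ] ∑[ z < v ] ⟦ Completes? w y z ⟧ ≡⟨ ∑-comm (λ y w → count (Completes? w y)) ⟩
      ∑[ w < v ] ∑[ y < v ] ∑[ z < v ] ⟦ Completes? w y z ⟧ ≤⟨ ∑-mono-≤ pairs-completed-by ⟩
      ∑[ w < v ] (⟦ ND? x w ⟧ * (2 * ⌊ nonpartners /2⌋))   ≡⟨ sym (*-distribʳ-sum (2 * ⌊ nonpartners /2⌋) (λ w → ⟦ ND? x w ⟧)) ⟩
      degree * (2 * ⌊ nonpartners /2⌋)                      ∎
      where open ≤-Reasoning

    half-degree : v % 4 ≡ 2 → 2 < v → v ≤ 2 * degree
    half-degree v%4≡2 2<v = majority {m = degree} {h = nonpartners} v%4≡2 2<v degree+nonpartners nonpartner-pairs-bound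

  open AtPoint using (degree; half-degree)

  ndPairCount : ℕ
  ndPairCount = ∑[ x < v ] count (λ y → (x <? y) ×-dec ND? x y)

  ndPairs-listed : AtLeastNDPairs B ndPairCount
  ndPairs-listed =
    filter P? pairs , filter⁺ P? (cartesianProduct⁺ (allFin⁺ v) (allFin⁺ v)) , length-filter-allPairs P? , all-filter P? pairs
    where
    pairs : List (Fin v × Fin v)
    pairs = cartesianProduct (allFin v) (allFin v)
    P? : ∀ p → Dec (proj₁ p <ᶠ proj₂ p × IsNDPair B (proj₁ p) (proj₂ p))
    P? (x , y) = (x <? y) ×-dec ND? x y

  many-ndPairs : v % 4 ≡ 2 → 2 < v → v * v ≤ 4 * ndPairCount
  many-ndPairs v%4≡2 2<v = begin
    v * v                           ≡⟨ sym (∑-const v v) ⟩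
    ∑[ x < v ] v                    ≤⟨ ∑-mono-≤ (λ x → half-degree x v%4≡2 2<v) ⟩
    ∑[ x < v ] (2 * degree x)       ≡⟨ sym (*-distribˡ-sum 2 degree) ⟩
    2 * ∑[ x < v ] degree x         ≡⟨ cong (2 *_) (handshake ND? ND-sym ND-irrefl) ⟩
    2 * (2 * ndPairCount)           ≡⟨ sym (*-assoc 2 2 ndPairCount) ⟩
    4 * ndPairCount                 ∎
    where open ≤-Reasoning

corollary2p8 : (v : ℕ) → 2 < v → (v % 12 ≡ 2 ⊎ v % 12 ≡ 10) →
    (B : List (NestedBlock v)) → IsNestedSQS v B →
    ∃ λ n → AtLeastNDPairs B n × v * v ≤ 4 * n
corollary2p8 v 2<v v%12 B sqs = ndPairCount , ndPairs-listed , many-ndPairs (%12⇒%4 v v%12) 2<v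
  where open NestedSQS {B = B} sqs
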